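{- Let $m$ and $M$ be positive integers such that $\rho (m,M) = 3$. Then $\min (m,M) \geq 22$, and if $\min (m,M)= 22$ then $\max(m,M)\geq 78$. Moreover, $\rho(22,78)=3$.
   Context: For positive integers $m,M$ define $\rho(m,M)=\min\{t\in\mathbb{Z}_{\ge 0} : \exists\, t'\in\mathbb{Z},\ 0\le t'\le t,\ \gcd(M-t',\,m-(t-t'))=1\}$. -}

module Defs where

open import Data.Nat using (ℕ; _≤_; _<_)
open import Data.Integer as ℤ using (ℤ; +_; _-_)
open import Data.Integer.GCD using (gcd)
open import Data.Product using (Σ; _×_)
open import Relation.Nullary using (¬_)
open import Relation.Binary.PropositionalEquality using (_≡_)

-- Good m M t :  ∃ t' ∈ ℤ, 0 ≤ t' ≤ t, gcd(M - t', m - (t - t')) = 1  (gcd over ℤ)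
-- (t' ranges over naturals ≤ t, which is the same as integers with 0 ≤ t' ≤ t)
Good : ℕ → ℕ → ℕ → Set
Good m M t = Σ ℕ λ t' → t' ≤ t × gcd (+ M - + t') (+ m - (+ t - + t')) ≡ + 1

IsRho : ℕ → ℕ → ℕ → Set
IsRho m M r = Good m M r × (∀ t → t < r → ¬ Good m M t)

-- Write (i , j) for the pair (M - i , m - j), so ρ(m,M) ≥ 3 says that gcd(M - i , m - j) > 1
-- whenever i + j ≤ 2.  For each such shift pick a divisor x ≥ 2 of m - j; then M solves the
-- system of six congruences M ≡ i (mod x), which must therefore be pairwise compatible
-- (gcd x y ∣ i - i').  For m ≤ 21 a finite search over the divisors of m, m - 1, m - 2 shows
-- that no choice of divisors is compatible.  The bound ρ(m,M) ≤ m - 1 (take t' = 0) disposes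
-- of m ≤ 3 and, as ρ is symmetric, of M ≤ 3.  The case m = 22 with M < 78 and the value
-- ρ(22,78) = 3 are direct computations.
module Submission where

open import Defs
open import Data.Nat using (ℕ; _≤_; _⊓_; _⊔_; NonZero)
open import Data.Product using (_×_)
open import Relation.Binary.PropositionalEquality using (_≡_)

open import Data.Nat.Base using (suc; pred; _+_; _∸_; _<_; ∣_-_∣; z≤n; s≤s; ≢-nonZero)
open import Data.Nat.Properties
  using ( _≤?_; _<?_; _≟_; ≤-trans; ≤-total; <⇒≤; <⇒≢; ≤∧≢⇒<; ≮⇒≥; ≰⇒>; n≢0⇒n>0; n≤1+n; pred-mono-≤
        ; m≤m+n; m≤n+m; m∸n≤m; m>n⇒m∸n≢0; m∸[m∸n]≡n; m+n∸m≡n; m+n∸n≡m; +-∸-assoc; m∸n+n≡m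
        ; m≤n⇒∣m-n∣≡n∸m; ∣-∣-comm; ⊓-glb; ⊓-sel; m≤m⊔n; m≤n⊔m )
open import Data.Nat.Divisibility using (_∣_; _∣?_; ∣-trans; ∣⇒≤; ∣m+n∣m⇒∣n; ∣1⇒≡1)
open import Data.Nat.GCD using (gcd; gcd[m,n]∣m; gcd[m,n]∣n; gcd[m,n]≢0; gcd-greatest; gcd-zeroʳ)
open import Data.Integer.Base as ℤ using (+_)
import Data.Integer.GCD as ℤ
open import Data.Integer.Properties using (m-n≡m⊖n; ⊖-≥)
open import Data.List.Base using (List; []; _∷_; filter; upTo)
open import Data.List.Membership.Propositional using (_∈_)
open import Data.List.Membership.Propositional.Properties using (∈-filter⁺; ∈-filter⁻; ∈-upTo⁺)
open import Data.List.Relation.Unary.All as All using (All; []; _∷_; all?)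
open import Data.List.Relation.Unary.All.Properties using (All¬⇒¬Any)
open import Data.List.Relation.Unary.Any using (Any; any?)
open import Data.List.Relation.Unary.AllPairs using (AllPairs; []; _∷_; allPairs?)
open import Data.Product using (Σ; _,_; proj₂)
open import Data.Sum using (inj₁; inj₂)
open import Data.Empty using (⊥-elim)
open import Function using (_∘_)
open import Relation.Nullary using (¬_; Dec; yes; no)
open import Relation.Nullary.Decidable using (True; toWitness; _×-dec_; _→-dec_; ¬?)
open import Relation.Unary using (Decidable)
open import Relation.Binary.PropositionalEquality using (_≢_; refl; sym; trans; cong; cong₂; subst)
open Relation.Binary.PropositionalEquality.≡-Reasoning

decideBelow : ∀ {P : ℕ → Set} (P? : Decidable P) n → {True (all? P? (upTo n))} → ∀ {m} → m < n → P m
decideBelow P? n {all-yes} m<n = All.lookup (toWitness all-yes) (∈-upTo⁺ m<n)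

+m-+n≡+[m∸n] : ∀ {m n} → n ≤ m → + m ℤ.- + n ≡ + (m ∸ n)
+m-+n≡+[m∸n] {m} {n} n≤m = trans (m-n≡m⊖n m n) (⊖-≥ n≤m)

∣n∸r∣n∸s⇒∣s∸r : ∀ {d n r s} → r ≤ s → s ≤ n → d ∣ n ∸ r → d ∣ n ∸ s → d ∣ s ∸ r
∣n∸r∣n∸s⇒∣s∸r {d} {n} {r} {s} r≤s s≤n d∣n∸r d∣n∸s = ∣m+n∣m⇒∣n (subst (d ∣_) (sym split) d∣n∸r) d∣n∸s
  where
  split : n ∸ s + (s ∸ r) ≡ n ∸ r
  split = begin
    n ∸ s + (s ∸ r)  ≡⟨ sym (+-∸-assoc (n ∸ s) r≤s) ⟩
    (n ∸ s + s) ∸ r  ≡⟨ cong (_∸ r) (m∸n+n≡m s≤n) ⟩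
    n ∸ r            ∎

∣n∸r∣n∸s⇒∣∣r-s∣ : ∀ {d n r s} → r ≤ n → s ≤ n → d ∣ n ∸ r → d ∣ n ∸ s → d ∣ ∣ r - s ∣
∣n∸r∣n∸s⇒∣∣r-s∣ {d} {n} {r} {s} r≤n s≤n d∣n∸r d∣n∸s with ≤-total r s
... | inj₁ r≤s = subst (d ∣_) (sym (m≤n⇒∣m-n∣≡n∸m r≤s)) (∣n∸r∣n∸s⇒∣s∸r r≤s s≤n d∣n∸r d∣n∸s)
... | inj₂ s≤r = subst (d ∣_) (sym (trans (∣-∣-comm r s) (m≤n⇒∣m-n∣≡n∸m s≤r)))
                   (∣n∸r∣n∸s⇒∣s∸r s≤r r≤n d∣n∸s d∣n∸r)

good-sym : ∀ {m M t} → Good m M t → Good M m t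
good-sym {m} {M} {t} (t' , t'≤t , coprime) = t ∸ t' , m∸n≤m t t' , (begin
  ℤ.gcd (+ m ℤ.- + (t ∸ t')) (+ M ℤ.- (+ t ℤ.- + (t ∸ t')))
    ≡⟨ cong₂ (λ a b → ℤ.gcd (+ m ℤ.- a) (+ M ℤ.- b)) (sym (+m-+n≡+[m∸n] t'≤t)) t-[t-t']≡t' ⟩
  ℤ.gcd (+ m ℤ.- (+ t ℤ.- + t')) (+ M ℤ.- + t')
    ≡⟨ ℤ.gcd-comm (+ m ℤ.- (+ t ℤ.- + t')) (+ M ℤ.- + t') ⟩
  ℤ.gcd (+ M ℤ.- + t') (+ m ℤ.- (+ t ℤ.- + t'))
    ≡⟨ coprime ⟩
  + 1 ∎)
  where
  t-[t-t']≡t' : + t ℤ.- + (t ∸ t') ≡ + t'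
  t-[t-t']≡t' = trans (+m-+n≡+[m∸n] (m∸n≤m t t')) (cong +_ (m∸[m∸n]≡n t'≤t))

RhoAtLeast : ℕ → ℕ → ℕ → Set
RhoAtLeast m M r = ∀ t → t < r → ¬ Good m M t

rhoAtLeast-sym : ∀ {m M r} → RhoAtLeast m M r → RhoAtLeast M m r
rhoAtLeast-sym ρ≥r t t<r = ρ≥r t t<r ∘ good-sym

Shift : Set
Shift = ℕ × ℕ

size : Shift → ℕ
size (i , j) = i + j

CoprimeAt : ℕ → ℕ → Shift → Set
CoprimeAt m M (i , j) = gcd (M ∸ i) (m ∸ j) ≡ 1

coprimeAt? : ∀ m M s → Dec (CoprimeAt m M s)
coprimeAt? m M (i , j) = gcd (M ∸ i) (m ∸ j) ≟ 1

coprimeAt⇒good : ∀ {m M i j} → i ≤ M → j ≤ m → CoprimeAt m M (i , j) → Good m M (i + j)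
coprimeAt⇒good {m} {M} {i} {j} i≤M j≤m coprime = i , m≤m+n i j , (begin
  ℤ.gcd (+ M ℤ.- + i) (+ m ℤ.- (+ (i + j) ℤ.- + i))
    ≡⟨ cong₂ (λ a b → ℤ.gcd a (+ m ℤ.- b)) (+m-+n≡+[m∸n] i≤M) [i+j]-i≡j ⟩
  ℤ.gcd (+ (M ∸ i)) (+ m ℤ.- + j)
    ≡⟨ cong (ℤ.gcd (+ (M ∸ i))) (+m-+n≡+[m∸n] j≤m) ⟩
  + gcd (M ∸ i) (m ∸ j)
    ≡⟨ cong +_ coprime ⟩
  + 1 ∎)
  where
  [i+j]-i≡j : + (i + j) ℤ.- + i ≡ + j
  [i+j]-i≡j = trans (+m-+n≡+[m∸n] (m≤m+n i j)) (cong +_ (m+n∸m≡n i j))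

good-pred : ∀ {m} M → NonZero m → Good m M (pred m)
good-pred {suc k} M _ = coprimeAt⇒good z≤n (n≤1+n k) (trans (cong (gcd M) (m+n∸n≡m 1 k)) (gcd-zeroʳ M))

rhoAtLeast3⇒4≤ : ∀ {m M} → NonZero m → RhoAtLeast m M 3 → 4 ≤ m
rhoAtLeast3⇒4≤ {m} {M} m≢0 ρ≥3 with m ≤? 3
... | yes m≤3 = ⊥-elim (ρ≥3 (pred m) (s≤s (pred-mono-≤ m≤3)) (good-pred M m≢0))
... | no m≰3 = ≰⇒> m≰3

smallShifts : List Shift
smallShifts = (0 , 0) ∷ (0 , 1) ∷ (0 , 2) ∷ (1 , 0) ∷ (1 , 1) ∷ (2 , 0) ∷ []

smallShifts-size≤2 : All (λ s → size s ≤ 2) smallShifts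
smallShifts-size≤2 = toWitness {a? = all? (λ s → size s ≤? 2) smallShifts} _

divisors≥2 : ℕ → List ℕ
divisors≥2 n = filter (λ x → 2 ≤? x ×-dec x ∣? n) (upTo (suc n))

∈-divisors≥2⁺ : ∀ {n x} → .{{NonZero n}} → 2 ≤ x → x ∣ n → x ∈ divisors≥2 n
∈-divisors≥2⁺ {n} 2≤x x∣n = ∈-filter⁺ (λ x → 2 ≤? x ×-dec x ∣? n) (∈-upTo⁺ {suc n} (s≤s (∣⇒≤ x∣n))) (2≤x , x∣n)

∈-divisors≥2⁻ : ∀ {n x} → x ∈ divisors≥2 n → 2 ≤ x × x ∣ n
∈-divisors≥2⁻ {n} x∈ = proj₂ (∈-filter⁻ (λ x → 2 ≤? x ×-dec x ∣? n) {xs = upTo (suc n)} x∈)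

-- (x , r) is the congruence  _ ≡ r (mod x).
Congruence : Set
Congruence = ℕ × ℕ

_Solves_ : ℕ → Congruence → Set
n Solves (x , r) = r ≤ n × x ∣ n ∸ r

Compatible : Congruence → Congruence → Set
Compatible (x , r) (y , s) = gcd x y ∣ ∣ r - s ∣

compatible? : ∀ c c′ → Dec (Compatible c c′)
compatible? (x , r) (y , s) = gcd x y ∣? ∣ r - s ∣

solves⇒compatible : ∀ {n c c′} → n Solves c → n Solves c′ → Compatible c c′
solves⇒compatible {c = x , _} {y , _} (r≤n , x∣n∸r) (s≤n , y∣n∸s) =
  ∣n∸r∣n∸s⇒∣∣r-s∣ r≤n s≤n (∣-trans (gcd[m,n]∣m x y) x∣n∸r) (∣-trans (gcd[m,n]∣n x y) y∣n∸s)

solvesAll⇒pairwiseCompatible : ∀ {n cs} → All (n Solves_) cs → AllPairs Compatible cs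
solvesAll⇒pairwiseCompatible [] = []
solvesAll⇒pairwiseCompatible (sol ∷ sols) =
  All.map (solves⇒compatible sol) sols ∷ solvesAll⇒pairwiseCompatible sols

AllSystems : ℕ → List Shift → (List Congruence → Set) → Set
AllSystems m [] P = P []
AllSystems m ((i , j) ∷ ss) P = All (λ x → AllSystems m ss (P ∘ ((x , i) ∷_))) (divisors≥2 (m ∸ j))

allSystems? : ∀ m ss {P : List Congruence → Set} → Decidable P → Dec (AllSystems m ss P)
allSystems? m [] P? = P? []
allSystems? m ((i , j) ∷ ss) P? = all? (λ x → allSystems? m ss (P? ∘ ((x , i) ∷_))) (divisors≥2 (m ∸ j))

CommonDivisorAt : ℕ → ℕ → Shift → Set
CommonDivisorAt m M (i , j) = Σ ℕ λ x → x ∈ divisors≥2 (m ∸ j) × M Solves (x , i)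

allSystems⇒solvedSystem : ∀ {m M P} ss → AllSystems m ss P → All (CommonDivisorAt m M) ss →
                    Σ (List Congruence) λ cs → P cs × All (M Solves_) cs
allSystems⇒solvedSystem [] p [] = [] , p , []
allSystems⇒solvedSystem ((i , j) ∷ ss) ps ((x , x∈ , sol) ∷ divs) with allSystems⇒solvedSystem ss (All.lookup ps x∈) divs
... | cs , p , sols = (x , i) ∷ cs , p , sol ∷ sols

notCoprime⇒commonDivisor : ∀ {m M i j} → i ≤ M → j < m → ¬ CoprimeAt m M (i , j) → CommonDivisorAt m M (i , j)
notCoprime⇒commonDivisor {m} {M} {i} {j} i≤M j<m g≢1 =
  g , ∈-divisors≥2⁺ {{≢-nonZero m∸j≢0}} 2≤g (gcd[m,n]∣n (M ∸ i) (m ∸ j)) , i≤M , gcd[m,n]∣m (M ∸ i) (m ∸ j)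
  where
  g : ℕ
  g = gcd (M ∸ i) (m ∸ j)
  m∸j≢0 : m ∸ j ≢ 0
  m∸j≢0 = m>n⇒m∸n≢0 j<m
  2≤g : 2 ≤ g
  2≤g = ≤∧≢⇒< (n≢0⇒n>0 (gcd[m,n]≢0 (M ∸ i) (m ∸ j) (inj₂ m∸j≢0))) (g≢1 ∘ sym)

commonDivisor⇒notCoprime : ∀ {m M s} → CommonDivisorAt m M s → ¬ CoprimeAt m M s
commonDivisor⇒notCoprime (x , x∈ , _ , x∣M∸i) g≡1 with 2≤x , x∣m∸j ← ∈-divisors≥2⁻ x∈ =
  <⇒≢ 2≤x (sym (∣1⇒≡1 (subst (x ∣_) g≡1 (gcd-greatest x∣M∸i x∣m∸j))))

rhoAtLeast3⇒commonDivisors : ∀ {m M} → 3 ≤ m → 2 ≤ M → RhoAtLeast m M 3 → All (CommonDivisorAt m M) smallShifts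
rhoAtLeast3⇒commonDivisors {m} {M} 3≤m 2≤M ρ≥3 = All.map commonDivisor smallShifts-size≤2
  where
  commonDivisor : ∀ {s} → size s ≤ 2 → CommonDivisorAt m M s
  commonDivisor {i , j} i+j≤2 =
    notCoprime⇒commonDivisor i≤M j<m (ρ≥3 (i + j) (s≤s i+j≤2) ∘ coprimeAt⇒good i≤M (<⇒≤ j<m))
    where
    i≤M : i ≤ M
    i≤M = ≤-trans (m≤m+n i j) (≤-trans i+j≤2 2≤M)
    j<m : j < m
    j<m = ≤-trans (s≤s (≤-trans (m≤n+m j i) i+j≤2)) 3≤m

IncompatibleSystems : ℕ → Set
IncompatibleSystems m = AllSystems m smallShifts (¬_ ∘ AllPairs Compatible)

incompatibleSystems? : ∀ m → Dec (IncompatibleSystems m)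
incompatibleSystems? m = allSystems? m smallShifts (¬? ∘ allPairs? compatible?)

incompatibleSystems-≤21 : ∀ {m} → m ≤ 21 → IncompatibleSystems m
incompatibleSystems-≤21 m≤21 = decideBelow incompatibleSystems? 22 (s≤s m≤21)

rhoAtLeast3⇒¬incompatibleSystems : ∀ {m M} → 3 ≤ m → 2 ≤ M → RhoAtLeast m M 3 → ¬ IncompatibleSystems m
rhoAtLeast3⇒¬incompatibleSystems 3≤m 2≤M ρ≥3 incompatible
  with cs , incompatible-cs , solved ← allSystems⇒solvedSystem {P = ¬_ ∘ AllPairs Compatible} smallShifts incompatible
                                         (rhoAtLeast3⇒commonDivisors 3≤m 2≤M ρ≥3)
  = incompatible-cs (solvesAll⇒pairwiseCompatible solved)

rhoAtLeast3⇒22≤ : ∀ {m M} → NonZero m → NonZero M → RhoAtLeast m M 3 → 22 ≤ m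
rhoAtLeast3⇒22≤ {m} {M} m≢0 M≢0 ρ≥3 with m ≤? 21
... | yes m≤21 = ⊥-elim (rhoAtLeast3⇒¬incompatibleSystems 3≤m 2≤M ρ≥3 (incompatibleSystems-≤21 m≤21))
  where
  3≤m : 3 ≤ m
  3≤m = ≤-trans (n≤1+n 3) (rhoAtLeast3⇒4≤ m≢0 ρ≥3)
  2≤M : 2 ≤ M
  2≤M = ≤-trans (m≤n+m 2 2) (rhoAtLeast3⇒4≤ M≢0 (rhoAtLeast-sym ρ≥3))
... | no m≰21 = ≰⇒> m≰21

coprimeShift-22 : ∀ {M} → 22 ≤ M → M < 78 → Any (CoprimeAt 22 M) smallShifts
coprimeShift-22 22≤M M<78 =
  decideBelow (λ M → 22 ≤? M →-dec any? (coprimeAt? 22 M) smallShifts) 78 M<78 22≤M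

rhoAtLeast3⇒78≤ : ∀ {m M} → m ≡ 22 → 22 ≤ M → RhoAtLeast m M 3 → 78 ≤ M
rhoAtLeast3⇒78≤ {M = M} refl 22≤M ρ≥3 with M <? 78
... | yes M<78 = ⊥-elim (All¬⇒¬Any notCoprime (coprimeShift-22 22≤M M<78))
  where
  notCoprime : All (¬_ ∘ CoprimeAt 22 M) smallShifts
  notCoprime = All.map (λ {s} → commonDivisor⇒notCoprime {s = s})
                       (rhoAtLeast3⇒commonDivisors (m≤n+m 3 19) (≤-trans (m≤n+m 2 20) 22≤M) ρ≥3)
... | no M≮78 = ≮⇒≥ M≮78

good-22-78 : Good 22 78 3
good-22-78 = 0 , z≤n , refl

rhoAtLeast3-22-78 : RhoAtLeast 22 78 3
rhoAtLeast3-22-78 0 _ (_ , z≤n , ())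
rhoAtLeast3-22-78 1 _ (_ , z≤n , ())
rhoAtLeast3-22-78 1 _ (_ , s≤s z≤n , ())
rhoAtLeast3-22-78 2 _ (_ , z≤n , ())
rhoAtLeast3-22-78 2 _ (_ , s≤s z≤n , ())
rhoAtLeast3-22-78 2 _ (_ , s≤s (s≤s z≤n) , ())
rhoAtLeast3-22-78 (suc (suc (suc _))) (s≤s (s≤s (s≤s ()))) _

lemma4p2 : ((m M : ℕ) → NonZero m → NonZero M → IsRho m M 3 →
               (22 ≤ m ⊓ M) × (m ⊓ M ≡ 22 → 78 ≤ m ⊔ M))
             × IsRho 22 78 3
lemma4p2 = bounds , good-22-78 , rhoAtLeast3-22-78
  where
  bounds : (m M : ℕ) → NonZero m → NonZero M → IsRho m M 3 → (22 ≤ m ⊓ M) × (m ⊓ M ≡ 22 → 78 ≤ m ⊔ M)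
  bounds m M m≢0 M≢0 (_ , ρ≥3) = ⊓-glb 22≤m 22≤M , 78≤max
    where
    22≤m : 22 ≤ m
    22≤m = rhoAtLeast3⇒22≤ m≢0 M≢0 ρ≥3
    22≤M : 22 ≤ M
    22≤M = rhoAtLeast3⇒22≤ M≢0 m≢0 (rhoAtLeast-sym ρ≥3)
    78≤max : m ⊓ M ≡ 22 → 78 ≤ m ⊔ M
    78≤max min≡22 with ⊓-sel m M
    ... | inj₁ min≡m = ≤-trans (rhoAtLeast3⇒78≤ (trans (sym min≡m) min≡22) 22≤M ρ≥3) (m≤n⊔m m M)
    ... | inj₂ min≡M = ≤-trans (rhoAtLeast3⇒78≤ (trans (sym min≡M) min≡22) 22≤m (rhoAtLeast-sym ρ≥3)) (m≤m⊔n m M)
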